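{- Let $G(V,E)$ be a graph with $\mathcal{R}_\pi(G)=k$. Then every word $w$ that is a concatenation of $k$ permutations of $V$ and is a $1$-$11$-representation of $G$ is cube-free.
   Context: For a word $w$ and letters $x,y$, $w_{\{x,y\}}$ denotes the word obtained from $w$ by deleting all letters other than $x$ and $y$. A word $w\in V^{+}$ is a $1$-$11$-representation of a graph $G(V,E)$ if for all distinct $x,y\in V$: $x,y$ are adjacent in $G$ iff $w_{\{x,y\}}$ contains at most one factor of the form $xx$ or $yy$ in total (equivalently, non-adjacent iff $w_{\{x,y\}}$ contains at least two occurrences of $xx$, or at least two of $yy$, or at least one of each). A $1$-$11$-representation is permutational if it is a concatenation of permutations of $V$ (words in which each vertex occurs exactly once). $\mathcal{R}_\pi(G)$ is the minimum number of permutations in a permutational $1$-$11$-representation of $G$ (every graph has one). A word is cube-free if it cannot be written as $s_1XXXs_2$ with $s_1,s_2$ possibly empty and $X$ nonempty. -}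

module Defs where

open import Data.Nat using (ℕ; zero; suc; _+_; _≤_; _<_)
open import Data.Fin using (Fin)
open import Data.Fin.Properties using (_≟_)
open import Data.List using (List; []; _∷_; _++_; filter; length; concat)
open import Data.List.Relation.Unary.Any using (Any)
open import Data.List.Relation.Unary.All using (All)
open import Data.Product using (Σ; _×_; ∃; _,_)
open import Data.Sum using (_⊎_)
open import Relation.Nullary using (¬_; Dec; yes; no)
open import Relation.Nullary.Decidable using (_⊎-dec_)
open import Relation.Binary.PropositionalEquality using (_≡_; _≢_)

record Graph (n : ℕ) : Set₁ where
  field
    Adj       : Fin n → Fin n → Set
    symmetric : ∀ {x y} → Adj x y → Adj y x
    irreflex  : ∀ {x} → ¬ Adj x x

Word : ℕ → Set
Word n = List (Fin n)

restrict : ∀ {n} → Fin n → Fin n → Word n → Word n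
restrict x y = filter (λ z → (z ≟ x) ⊎-dec (z ≟ y))

-- number of occurrences of the factor x x in a word (overlapping occurrences counted)
countXX : ∀ {n} → Fin n → Word n → ℕ
countXX x []      = 0
countXX x (a ∷ w) = go a w
  where
  go : _ → Word _ → ℕ
  go a []      = 0
  go a (b ∷ w) with a ≟ x | b ≟ x
  ... | yes _ | yes _ = suc (go b w)
  ... | _     | _     = go b w

Is1-11-Rep : ∀ {n} → Graph n → Word n → Set
Is1-11-Rep {n} G w =
  (w ≢ []) ×
  (∀ (x y : Fin n) → x ≢ y →
     (Graph.Adj G x y → countXX x (restrict x y w) + countXX y (restrict x y w) ≤ 1) ×
     (countXX x (restrict x y w) + countXX y (restrict x y w) ≤ 1 → Graph.Adj G x y))

IsPermutation : ∀ {n} → Word n → Set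
IsPermutation {n} p = ∀ (v : Fin n) → length (filter (v ≟_) p) ≡ 1

IsConcatOfPerms : ∀ {n} → ℕ → Word n → Set
IsConcatOfPerms {n} k w =
  Σ (List (Word n)) λ ps → (length ps ≡ k) × All IsPermutation ps × (concat ps ≡ w)

HasPermRep : ∀ {n} → Graph n → ℕ → Set
HasPermRep G k = Σ _ λ w → IsConcatOfPerms k w × Is1-11-Rep G w

Rπ≡ : ∀ {n} → Graph n → ℕ → Set
Rπ≡ G k = HasPermRep G k × (∀ j → j < k → ¬ HasPermRep G j)

CubeFree : ∀ {n} → Word n → Set
CubeFree {n} w = ∀ (s₁ X s₂ : Word n) → X ≢ [] → w ≢ s₁ ++ X ++ X ++ X ++ s₂

-- Let w = A X X X B be a concatenation of k = Rπ(G) permutations that represents G.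
-- In a prefix of a concatenation of permutations any two letters occur equally often
-- up to one, so comparing the prefixes A and A X X X shows that all letters occur in X
-- equally often, hence at least once.  Let p = A t be the permutation in which the
-- first X begins.  As t repeats no letter it is a prefix of X, say X = t X′; the later
-- permutations spell (X′ t) X′ X B, and their prefix X′ t, being balanced like X,
-- consists of whole permutations.  So A X X B = p X′ X B is a concatenation of fewer
-- than k permutations.  It still represents G: for distinct x, y the restriction Y
-- of X to {x, y} has even length.  If Y has a factor xx or yy then Y Y has two, and
-- x, y are non-adjacent for both words; otherwise Y alternates, so its first and last
-- letters differ, Y Y alternates too, and deleting one Y from Y Y Y does not change
-- the number of factors xx, yy.  This contradicts the minimality of k.

module Submission where

open import Defs
open import Algebra.Properties.CommutativeSemigroup using (interchange)
open import Data.Bool.Base using (if_then_else_)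
open import Data.Empty using (⊥-elim)
open import Data.Fin using (Fin)
open import Data.Fin.Properties using (_≟_)
open import Data.List using (List; []; _∷_; _++_; filter; length; concat)
open import Data.List.Properties
  using (++-assoc; ++-identityʳ; ++-conicalˡ; ++-conicalʳ; ∷-injective; length-++; filter-++)
open import Data.List.Relation.Unary.All using (All; []; _∷_)
open import Data.List.Relation.Unary.All.Properties using (all-filter)
open import Data.Nat using (ℕ; zero; suc; _+_; _*_; _≤_; _<_; z≤n; s≤s)
open import Data.Nat.Properties hiding (_≟_)
open import Data.Product using (∃; _×_; _,_)
open import Data.Sum using (_⊎_; inj₁; inj₂)
open import Function.Base using (_∘_; id)
open import Function.Bundles using (_⇔_; mk⇔; Equivalence)
open import Relation.Binary.Definitions using (Decidable)
open import Relation.Binary.PropositionalEquality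
open import Relation.Nullary using (¬_; Dec; does; yes; no; _×-dec_; _⊎-dec_)
open import Relation.Nullary.Decidable using (dec-true; dec-false)

++-split : ∀ {A : Set} (p q s r : List A) → p ++ q ≡ s ++ r →
  (∃ λ t → s ≡ p ++ t × q ≡ t ++ r) ⊎ (∃ λ t → p ≡ s ++ t × r ≡ t ++ q)
++-split []      q s       r eq = inj₁ (s , refl , eq)
++-split (a ∷ p) q []      r eq = inj₂ (a ∷ p , refl , sym eq)
++-split (a ∷ p) q (b ∷ s) r eq with ∷-injective eq
... | refl , eq′ with ++-split p q s r eq′
...   | inj₁ (t , s≡ , q≡) = inj₁ (t , cong (a ∷_) s≡ , q≡)
...   | inj₂ (t , p≡ , r≡) = inj₂ (t , cong (a ∷_) p≡ , r≡)

-- Letter occurrences and permutations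

occ : ∀ {n} → Fin n → Word n → ℕ
occ v w = length (filter (v ≟_) w)

occ-++ : ∀ {n} (v : Fin n) u w → occ v (u ++ w) ≡ occ v u + occ v w
occ-++ v u w = trans (cong length (filter-++ (v ≟_) u w)) (length-++ (filter (v ≟_) u))

occ-∷-self : ∀ {n} (v : Fin n) w → occ v (v ∷ w) ≡ suc (occ v w)
occ-∷-self v w rewrite dec-true (v ≟ v) refl = refl

occ-∷-other : ∀ {n} {v a : Fin n} w → v ≢ a → occ v (a ∷ w) ≡ occ v w
occ-∷-other {v = v} {a} w v≢a rewrite dec-false (v ≟ a) v≢a = refl

occ≡0⇒[] : ∀ {n} (w : Word n) → (∀ v → occ v w ≡ 0) → w ≡ []
occ≡0⇒[] []      _    = refl
occ≡0⇒[] (a ∷ w) none = ⊥-elim (0≢1+n (trans (sym (none a)) (occ-∷-self a w)))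

occ-perm-++ : ∀ {n} {u w : Word n} → IsPermutation (u ++ w) → ∀ v → occ v u + occ v w ≡ 1
occ-perm-++ {u = u} {w} perm v = trans (sym (occ-++ v u w)) (perm v)

occ-perm-prefix : ∀ {n} {u w : Word n} → IsPermutation (u ++ w) → ∀ v → occ v u ≤ 1
occ-perm-prefix {u = u} {w} perm v =
  ≤-trans (m≤m+n (occ v u) (occ v w)) (≤-reflexive (occ-perm-++ {u = u} {w} perm v))

occ-perm-suffix : ∀ {n} {u w : Word n} → IsPermutation (u ++ w) → ∀ v → occ v w ≤ 1
occ-perm-suffix {u = u} {w} perm v =
  ≤-trans (m≤n+m (occ v w) (occ v u)) (≤-reflexive (occ-perm-++ {u = u} {w} perm v))

Balanced : ∀ {n} → Word n → Set
Balanced w = ∀ u v → occ u w ≡ occ v w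

Balanced-occ-pos : ∀ {n} {w : Word n} → Balanced w → w ≢ [] → ∀ v → 0 < occ v w
Balanced-occ-pos {w = []}    _   w≢[] v = ⊥-elim (w≢[] refl)
Balanced-occ-pos {w = a ∷ w} bal _    v =
  subst (0 <_) (trans (sym (occ-∷-self a w)) (bal a v)) (s≤s z≤n)

Balanced-rotate : ∀ {n} {u w : Word n} → Balanced (u ++ w) → Balanced (w ++ u)
Balanced-rotate {u = u} {w} bal a b = begin
  occ a (w ++ u)     ≡⟨ occ-++ a w u ⟩
  occ a w + occ a u  ≡⟨ +-comm (occ a w) (occ a u) ⟩
  occ a u + occ a w  ≡⟨ sym (occ-++ a u w) ⟩
  occ a (u ++ w)     ≡⟨ bal a b ⟩
  occ b (u ++ w)     ≡⟨ occ-++ b u w ⟩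
  occ b u + occ b w  ≡⟨ +-comm (occ b u) (occ b w) ⟩
  occ b w + occ b u  ≡⟨ sym (occ-++ b w u) ⟩
  occ b (w ++ u)     ∎
  where open ≡-Reasoning

Balanced-dropPerm : ∀ {n} {p t : Word n} → IsPermutation p → Balanced (p ++ t) → Balanced t
Balanced-dropPerm {p = p} {t} perm bal a b = suc-injective (begin
  suc (occ a t)      ≡⟨ cong (_+ occ a t) (sym (perm a)) ⟩
  occ a p + occ a t  ≡⟨ sym (occ-++ a p t) ⟩
  occ a (p ++ t)     ≡⟨ bal a b ⟩
  occ b (p ++ t)     ≡⟨ occ-++ b p t ⟩
  occ b p + occ b t  ≡⟨ cong (_+ occ b t) (perm b) ⟩
  suc (occ b t)      ∎)
  where open ≡-Reasoning

Balanced-permPrefix-complete : ∀ {n} {Z t : Word n} → IsPermutation (Z ++ t) →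
  Balanced Z → Z ≢ [] → t ≡ []
Balanced-permPrefix-complete {Z = Z} {t} perm bal Z≢[] = occ≡0⇒[] t λ v →
  rest≡0 (Balanced-occ-pos bal Z≢[] v) (occ-perm-++ {u = Z} {t} perm v)
  where
  rest≡0 : ∀ {a b} → 0 < a → a + b ≡ 1 → b ≡ 0
  rest≡0 {suc a} _ eq = m+n≡0⇒n≡0 a (suc-injective eq)

-- Concatenations of permutations

ConcatOfFewerPerms : ∀ {n} → ℕ → Word n → Set
ConcatOfFewerPerms k w = ∃ λ j → j < k × IsConcatOfPerms j w

ConcatOfFewerPerms-∷ : ∀ {n k} {p w : Word n} → IsPermutation p →
  ConcatOfFewerPerms k w → ConcatOfFewerPerms (suc k) (p ++ w)
ConcatOfFewerPerms-∷ {p = p} perm (j , j<k , qs , refl , perms , refl) =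
  suc j , s≤s j<k , p ∷ qs , refl , perm ∷ perms , refl

occ-prefix-concatPerms : ∀ {n} (ps : List (Word n)) (s : Word n) {r} → All IsPermutation ps →
  concat ps ≡ s ++ r → ∀ u v → occ u s ≤ suc (occ v s)
occ-prefix-concatPerms []       []          _ _  u v = z≤n
occ-prefix-concatPerms (p ∷ ps) s {r} (perm ∷ perms) eq u v with ++-split p (concat ps) s r eq
... | inj₁ (t , refl , ps≡) rewrite occ-++ u p t | occ-++ v p t | perm u | perm v =
  s≤s (occ-prefix-concatPerms ps t perms ps≡ u v)
... | inj₂ (t , refl , _) = ≤-trans (occ-perm-prefix {u = s} {t} perm u) (s≤s z≤n)

thrice-cancel : ∀ a b {m n} → m + 3 * a ≤ suc (n + 3 * b) → n ≤ suc m → a ≤ b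
thrice-cancel a b {m} {n} h₁ h₂ = ≤-pred (*-cancelˡ-< 3 a (suc b) (begin-strict
  3 * a             ≤⟨ +-cancelˡ-≤ m (3 * a) (2 + 3 * b) (begin
    m + 3 * a           ≤⟨ h₁ ⟩
    suc (n + 3 * b)     ≤⟨ s≤s (+-monoˡ-≤ (3 * b) h₂) ⟩
    2 + (m + 3 * b)     ≡⟨ sym (trans (+-suc m (suc (3 * b))) (cong suc (+-suc m (3 * b)))) ⟩
    m + (2 + 3 * b)     ∎) ⟩
  2 + 3 * b         <⟨ n<1+n _ ⟩
  3 + 3 * b         ≡⟨ sym (*-suc 3 b) ⟩
  3 * suc b         ∎))
  where open ≤-Reasoning

cube-balanced : ∀ {n} {ps : List (Word n)} (A X B : Word n) → All IsPermutation ps →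
  concat ps ≡ A ++ X ++ X ++ X ++ B → Balanced X
cube-balanced {ps = ps} A X B perms eq u v = ≤-antisym (occ≤ u v) (occ≤ v u)
  where
  occ-cube : ∀ a → occ a (A ++ X ++ X ++ X) ≡ occ a A + 3 * occ a X
  occ-cube a = trans (occ-++ a A _) (cong (occ a A +_) (begin
    occ a (X ++ X ++ X)            ≡⟨ occ-++ a X _ ⟩
    occ a X + occ a (X ++ X)       ≡⟨ cong (occ a X +_) (occ-++ a X X) ⟩
    occ a X + (occ a X + occ a X)  ≡⟨ cong (λ k → occ a X + (occ a X + k)) (sym (+-identityʳ _)) ⟩
    3 * occ a X                    ∎))
    where open ≡-Reasoning

  eq′ : concat ps ≡ (A ++ X ++ X ++ X) ++ B
  eq′ = trans eq (sym (trans (++-assoc A (X ++ X ++ X) B)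
          (cong (A ++_) (trans (++-assoc X (X ++ X) B) (cong (X ++_) (++-assoc X X B))))))

  occ≤ : ∀ u v → occ u X ≤ occ v X
  occ≤ u v = thrice-cancel (occ u X) (occ v X)
    (subst₂ _≤_ (occ-cube u) (cong suc (occ-cube v))
      (occ-prefix-concatPerms ps (A ++ X ++ X ++ X) perms eq′ u v))
    (occ-prefix-concatPerms ps A perms eq v u)

dropBalancedPrefix : ∀ {n} (ps : List (Word n)) {Z R : Word n} → All IsPermutation ps →
  Balanced Z → Z ≢ [] → concat ps ≡ Z ++ R → ConcatOfFewerPerms (length ps) R
dropBalancedPrefix [] {[]}    _ _ Z≢[] _ = ⊥-elim (Z≢[] refl)
dropBalancedPrefix (p ∷ ps) {Z} {R} (perm ∷ perms) bal Z≢[] eq with ++-split p (concat ps) Z R eq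
... | inj₁ ([] , _ , ps≡R) = length ps , n<1+n _ , ps , refl , perms , ps≡R
... | inj₁ (t@(_ ∷ _) , refl , ps≡) =
  let j , j<k , perms′ = dropBalancedPrefix ps perms (Balanced-dropPerm {p = p} perm bal) (λ ()) ps≡
  in j , m<n⇒m<1+n j<k , perms′
... | inj₂ (t , refl , R≡) with refl ← Balanced-permPrefix-complete perm bal Z≢[] =
  length ps , n<1+n _ , ps , refl , perms , sym R≡

permPrefix-inSquare : ∀ {n} {t R Z B : Word n} → (∀ v → occ v t ≤ 1) → (∀ v → 0 < occ v Z) →
  Z ++ Z ++ B ≡ t ++ R → ∃ λ Z′ → Z ≡ t ++ Z′ × R ≡ Z′ ++ Z ++ B
permPrefix-inSquare {t = t} {R} {Z} {B} t≤1 Z>0 eq with ++-split Z (Z ++ B) t R eq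
... | inj₂ (Z′ , Z≡ , R≡) = Z′ , Z≡ , R≡
... | inj₁ ([] , t≡ , ZB≡) =
  [] , sym (trans (++-identityʳ t) (trans t≡ (++-identityʳ Z))) , sym ZB≡
... | inj₁ (z ∷ u , refl , _) = ⊥-elim (1+n≰n (≤-trans twice (t≤1 z)))
  where
  twice : 2 ≤ occ z (Z ++ z ∷ u)
  twice = subst (2 ≤_) (sym (trans (occ-++ z Z (z ∷ u)) (cong (occ z Z +_) (occ-∷-self z u))))
            (+-mono-≤ (Z>0 z) (s≤s z≤n))

halveSquare : ∀ {n} (ps : List (Word n)) (A : Word n) {Z B} → All IsPermutation ps →
  Balanced Z → Z ≢ [] → concat ps ≡ A ++ Z ++ Z ++ B → ConcatOfFewerPerms (length ps) (A ++ Z ++ B)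
halveSquare [] [] {[]} _ _ Z≢[] _ = ⊥-elim (Z≢[] refl)
halveSquare (p ∷ ps) A {Z} {B} (perm ∷ perms) bal Z≢[] eq with ++-split p (concat ps) A (Z ++ Z ++ B) eq
... | inj₁ (A′ , refl , ps≡) =
  subst (ConcatOfFewerPerms _) (sym (++-assoc p A′ (Z ++ B)))
    (ConcatOfFewerPerms-∷ {p = p} perm (halveSquare ps A′ perms bal Z≢[] ps≡))
... | inj₂ (t , refl , ZZB≡)
  with Z′ , refl , ps≡ ← permPrefix-inSquare {t = t} {concat ps} {Z} {B}
                            (occ-perm-suffix {u = A} perm) (Balanced-occ-pos bal Z≢[]) ZZB≡ =
  subst (ConcatOfFewerPerms _) assoc (ConcatOfFewerPerms-∷ {p = A ++ t} perm
    (dropBalancedPrefix ps perms (Balanced-rotate {u = t} bal) Z′t≢[] ps≡′))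
  where
  Z′t≢[] : Z′ ++ t ≢ []
  Z′t≢[] e = Z≢[] (cong₂ _++_ (++-conicalʳ Z′ t e) (++-conicalˡ Z′ t e))
  ps≡′ : concat ps ≡ (Z′ ++ t) ++ Z′ ++ B
  ps≡′ = trans ps≡ (trans (cong (Z′ ++_) (++-assoc t Z′ B)) (sym (++-assoc Z′ t (Z′ ++ B))))
  assoc : (A ++ t) ++ Z′ ++ B ≡ A ++ (t ++ Z′) ++ B
  assoc = trans (++-assoc A t (Z′ ++ B)) (cong (A ++_) (sym (++-assoc t Z′ B)))

-- Counting adjacent pairs

indicator : ∀ {P : Set} → Dec P → ℕ
indicator P? = if does P? then 1 else 0

indicator≡0 : ∀ {P : Set} (P? : Dec P) → indicator P? ≡ 0 → ¬ P
indicator≡0 (yes _) () _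
indicator≡0 (no ¬p) _  = ¬p

indicator-¬ : ∀ {P : Set} (P? : Dec P) → ¬ P → indicator P? ≡ 0
indicator-¬ (yes p) ¬p = ⊥-elim (¬p p)
indicator-¬ (no _)  _  = refl

lastOr : ∀ {A : Set} → A → List A → A
lastOr c []      = c
lastOr _ (b ∷ l) = lastOr b l

lastOr-++-∷ : ∀ {A : Set} (c : A) u b w → lastOr c (u ++ b ∷ w) ≡ lastOr b w
lastOr-++-∷ c []      b w = refl
lastOr-++-∷ c (d ∷ u) b w = lastOr-++-∷ d u b w

module _ {A : Set} {R : A → A → Set} (R? : Decidable R) where

  countAdjacentFrom : A → List A → ℕ
  countAdjacentFrom c []      = 0
  countAdjacentFrom c (b ∷ l) = indicator (R? c b) + countAdjacentFrom b l

  countAdjacent : List A → ℕ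
  countAdjacent []      = 0
  countAdjacent (c ∷ l) = countAdjacentFrom c l

  countAdjacentFrom-++ : ∀ c u w →
    countAdjacentFrom c (u ++ w) ≡ countAdjacentFrom c u + countAdjacentFrom (lastOr c u) w
  countAdjacentFrom-++ c []      w = refl
  countAdjacentFrom-++ c (b ∷ u) w =
    trans (cong (indicator (R? c b) +_) (countAdjacentFrom-++ b u w))
          (sym (+-assoc (indicator (R? c b)) _ _))

  countAdjacent≤countAdjacentFrom : ∀ c w → countAdjacent w ≤ countAdjacentFrom c w
  countAdjacent≤countAdjacentFrom c []      = z≤n
  countAdjacent≤countAdjacentFrom c (b ∷ w) = m≤n+m _ _

  countAdjacent-++ : ∀ u w → countAdjacent u + countAdjacent w ≤ countAdjacent (u ++ w)
  countAdjacent-++ []      w = ≤-refl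
  countAdjacent-++ (c ∷ u) w = begin
    countAdjacentFrom c u + countAdjacent w
      ≤⟨ +-monoʳ-≤ _ (countAdjacent≤countAdjacentFrom (lastOr c u) w) ⟩
    countAdjacentFrom c u + countAdjacentFrom (lastOr c u) w
      ≡⟨ sym (countAdjacentFrom-++ c u w) ⟩
    countAdjacentFrom c (u ++ w) ∎
    where open ≤-Reasoning

  countAdjacent-square : ∀ P u S → countAdjacent u + countAdjacent u ≤ countAdjacent (P ++ u ++ u ++ S)
  countAdjacent-square P u S = begin
    countAdjacent u + countAdjacent u
      ≤⟨ +-monoʳ-≤ _ (≤-trans (m≤m+n _ _) (countAdjacent-++ u S)) ⟩
    countAdjacent u + countAdjacent (u ++ S)
      ≤⟨ countAdjacent-++ u (u ++ S) ⟩
    countAdjacent (u ++ u ++ S)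
      ≤⟨ m≤n+m _ _ ⟩
    countAdjacent P + countAdjacent (u ++ u ++ S)
      ≤⟨ countAdjacent-++ P (u ++ u ++ S) ⟩
    countAdjacent (P ++ u ++ u ++ S) ∎
    where open ≤-Reasoning

  countAdjacent-++-∷-++ : ∀ P y Y S →
    countAdjacent (P ++ (y ∷ Y) ++ S) ≡ countAdjacent (P ++ y ∷ Y) + countAdjacentFrom (lastOr y Y) S
  countAdjacent-++-∷-++ []      y Y S = countAdjacentFrom-++ y Y S
  countAdjacent-++-∷-++ (c ∷ P) y Y S = begin
    countAdjacentFrom c (P ++ (y ∷ Y) ++ S)
      ≡⟨ cong (countAdjacentFrom c) (sym (++-assoc P (y ∷ Y) S)) ⟩
    countAdjacentFrom c ((P ++ y ∷ Y) ++ S)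
      ≡⟨ countAdjacentFrom-++ c (P ++ y ∷ Y) S ⟩
    countAdjacentFrom c (P ++ y ∷ Y) + countAdjacentFrom (lastOr c (P ++ y ∷ Y)) S
      ≡⟨ cong (λ d → countAdjacentFrom c (P ++ y ∷ Y) + countAdjacentFrom d S)
              (lastOr-++-∷ c P y Y) ⟩
    countAdjacentFrom c (P ++ y ∷ Y) + countAdjacentFrom (lastOr y Y) S ∎
    where open ≡-Reasoning

  countAdjacent-collapseSquare : ∀ P y Y S → countAdjacentFrom (lastOr y Y) (y ∷ Y) ≡ 0 →
    countAdjacent (P ++ (y ∷ Y) ++ (y ∷ Y) ++ S) ≡ countAdjacent (P ++ (y ∷ Y) ++ S)
  countAdjacent-collapseSquare P y Y S none = begin
    countAdjacent (P ++ (y ∷ Y) ++ (y ∷ Y) ++ S)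
      ≡⟨ countAdjacent-++-∷-++ P y Y ((y ∷ Y) ++ S) ⟩
    countAdjacent (P ++ y ∷ Y) + countAdjacentFrom L ((y ∷ Y) ++ S)
      ≡⟨ cong (countAdjacent (P ++ y ∷ Y) +_) (countAdjacentFrom-++ L (y ∷ Y) S) ⟩
    countAdjacent (P ++ y ∷ Y) + (countAdjacentFrom L (y ∷ Y) + countAdjacentFrom L S)
      ≡⟨ cong (λ k → countAdjacent (P ++ y ∷ Y) + (k + countAdjacentFrom L S)) none ⟩
    countAdjacent (P ++ y ∷ Y) + countAdjacentFrom L S
      ≡⟨ sym (countAdjacent-++-∷-++ P y Y S) ⟩
    countAdjacent (P ++ (y ∷ Y) ++ S) ∎
    where
    open ≡-Reasoning
    L = lastOr y Y

countAdjacentFrom-+ : ∀ {A : Set} {P Q R : A → A → Set} {S : A → Set}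
  (P? : Decidable P) (Q? : Decidable Q) (R? : Decidable R) →
  (∀ {a b} → S a → S b → indicator (P? a b) + indicator (Q? a b) ≡ indicator (R? a b)) →
  ∀ {c l} → S c → All S l →
  countAdjacentFrom P? c l + countAdjacentFrom Q? c l ≡ countAdjacentFrom R? c l
countAdjacentFrom-+ P? Q? R? split {l = []}    _  _           = refl
countAdjacentFrom-+ P? Q? R? split {c} {b ∷ l} sc (sb ∷ sl) =
  trans (interchange +-commutativeSemigroup (indicator (P? c b)) _ (indicator (Q? c b)) _)
        (cong₂ _+_ (split sc sb) (countAdjacentFrom-+ P? Q? R? split sb sl))

-- Restriction to two letters

bothEqual? : ∀ {n} (z : Fin n) → Decidable (λ a b → a ≡ z × b ≡ z)
bothEqual? z a b = (a ≟ z) ×-dec (b ≟ z)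

countXX-∷ : ∀ {n} (z a : Fin n) l → countXX z (a ∷ l) ≡ countAdjacentFrom (bothEqual? z) a l
countXX-∷ z a []      = refl
countXX-∷ z a (b ∷ l) with a ≟ z | b ≟ z
... | yes _ | yes _ = cong suc (countXX-∷ z b l)
... | yes _ | no _  = countXX-∷ z b l
... | no _  | _     = countXX-∷ z b l

module TwoLetters {n} {x y : Fin n} (x≢y : x ≢ y) where

  OneOf : Fin n → Set
  OneOf z = z ≡ x ⊎ z ≡ y

  repeats : Word n → ℕ
  repeats = countAdjacent _≟_

  indicator-split : ∀ {a b} → OneOf a → OneOf b →
    indicator (bothEqual? x a b) + indicator (bothEqual? y a b) ≡ indicator (a ≟ b)
  indicator-split (inj₁ refl) (inj₁ refl)
    rewrite dec-true (x ≟ x) refl | dec-false (x ≟ y) x≢y = refl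
  indicator-split (inj₁ refl) (inj₂ refl)
    rewrite dec-true (x ≟ x) refl | dec-true (y ≟ y) refl
          | dec-false (x ≟ y) x≢y | dec-false (y ≟ x) (x≢y ∘ sym) = refl
  indicator-split (inj₂ refl) (inj₁ refl)
    rewrite dec-true (x ≟ x) refl | dec-true (y ≟ y) refl
          | dec-false (x ≟ y) x≢y | dec-false (y ≟ x) (x≢y ∘ sym) = refl
  indicator-split (inj₂ refl) (inj₂ refl)
    rewrite dec-true (y ≟ y) refl | dec-false (y ≟ x) (x≢y ∘ sym) = refl

  countXX-repeats : ∀ w → All OneOf w → countXX x w + countXX y w ≡ repeats w
  countXX-repeats []      _         = refl
  countXX-repeats (a ∷ w) (oa ∷ ow) =
    trans (cong₂ _+_ (countXX-∷ x a w) (countXX-∷ y a w))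
          (countAdjacentFrom-+ (bothEqual? x) (bothEqual? y) _≟_ indicator-split oa ow)

  otherLetter : ∀ {a b c} → OneOf a → OneOf b → OneOf c → a ≢ b → b ≢ c → a ≡ c
  otherLetter (inj₁ refl) (inj₁ refl) _           a≢b _   = ⊥-elim (a≢b refl)
  otherLetter (inj₂ refl) (inj₂ refl) _           a≢b _   = ⊥-elim (a≢b refl)
  otherLetter _           (inj₁ refl) (inj₁ refl) _   b≢c = ⊥-elim (b≢c refl)
  otherLetter _           (inj₂ refl) (inj₂ refl) _   b≢c = ⊥-elim (b≢c refl)
  otherLetter (inj₁ refl) (inj₂ refl) (inj₁ refl) _   _   = refl
  otherLetter (inj₂ refl) (inj₁ refl) (inj₂ refl) _   _   = refl

  alternating-closed-even : ∀ c l → OneOf c → All OneOf l →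
    countAdjacentFrom _≟_ c l ≡ 0 → lastOr c l ≡ c → ∃ λ m → length l ≡ 2 * m
  alternating-closed-even c []           _  _                 _    _    = 0 , refl
  alternating-closed-even c (b ∷ [])     _  _                 none refl =
    ⊥-elim (indicator≡0 (b ≟ b) (m+n≡0⇒m≡0 _ none) refl)
  alternating-closed-even c (b ∷ d ∷ l)  oc (ob ∷ od ∷ ol) none last =
    let rest = m+n≡0⇒n≡0 (indicator (c ≟ b)) none
        c≡d  = otherLetter oc ob od (indicator≡0 (c ≟ b) (m+n≡0⇒m≡0 _ none))
                 (indicator≡0 (b ≟ d) (m+n≡0⇒m≡0 _ rest))
        m , len≡ = alternating-closed-even d l od ol
                     (m+n≡0⇒n≡0 (indicator (b ≟ d)) rest) (trans last c≡d)
    in suc m , trans (cong (suc ∘ suc) len≡) (sym (*-suc 2 m))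

  repeats-cube⇔square : ∀ P Y S → All OneOf Y → (∃ λ m → length Y ≡ 2 * m) →
    (repeats (P ++ Y ++ Y ++ Y ++ S) ≤ 1) ⇔ (repeats (P ++ Y ++ Y ++ S) ≤ 1)
  repeats-cube⇔square P []      S _         _ = mk⇔ id id
  repeats-cube⇔square P (y ∷ Y) S (oy ∷ oY) (m , len≡) with countAdjacentFrom _≟_ y Y in alt
  ... | zero = mk⇔ (subst (_≤ 1) collapse) (subst (_≤ 1) (sym collapse))
    where
    ends-differ : lastOr y Y ≢ y
    ends-differ closed =
      let m′ , len′ = alternating-closed-even y Y oy oY alt closed
      in even≢odd m m′ (trans (sym len≡) (cong suc len′))
    collapse : repeats (P ++ (y ∷ Y) ++ (y ∷ Y) ++ (y ∷ Y) ++ S)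
             ≡ repeats (P ++ (y ∷ Y) ++ (y ∷ Y) ++ S)
    collapse = countAdjacent-collapseSquare _≟_ P y Y ((y ∷ Y) ++ S)
      (cong₂ _+_ (indicator-¬ (lastOr y Y ≟ y) ends-differ) alt)
  ... | suc d = mk⇔ (⊥-elim ∘ tooMany ((y ∷ Y) ++ S)) (⊥-elim ∘ tooMany S)
    where
    tooMany : ∀ S′ → ¬ (repeats (P ++ (y ∷ Y) ++ (y ∷ Y) ++ S′) ≤ 1)
    tooMany S′ h = 1+n≰n (≤-trans two (≤-trans (countAdjacent-square _≟_ P (y ∷ Y) S′) h))
      where
      two : 2 ≤ repeats (y ∷ Y) + repeats (y ∷ Y)
      two rewrite alt = s≤s (≤-trans (s≤s z≤n) (m≤n+m (suc d) d))

  length-restrict : ∀ w → length (restrict x y w) ≡ occ x w + occ y w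
  length-restrict []      = refl
  length-restrict (a ∷ w) with a ≟ x
  ... | yes refl = begin
    suc (length (restrict x y w))     ≡⟨ cong suc (length-restrict w) ⟩
    suc (occ x w + occ y w)
      ≡⟨ cong₂ _+_ (sym (occ-∷-self x w)) (sym (occ-∷-other w (x≢y ∘ sym))) ⟩
    occ x (x ∷ w) + occ y (x ∷ w)     ∎
    where open ≡-Reasoning
  ... | no a≢x with a ≟ y
  ...   | yes refl = begin
    suc (length (restrict x y w))     ≡⟨ cong suc (length-restrict w) ⟩
    suc (occ x w + occ y w)           ≡⟨ sym (+-suc (occ x w) (occ y w)) ⟩
    occ x w + suc (occ y w)
      ≡⟨ cong₂ _+_ (sym (occ-∷-other w x≢y)) (sym (occ-∷-self y w)) ⟩
    occ x (y ∷ w) + occ y (y ∷ w)     ∎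
    where open ≡-Reasoning
  ...   | no a≢y = trans (length-restrict w)
    (cong₂ _+_ (sym (occ-∷-other w (a≢x ∘ sym))) (sym (occ-∷-other w (a≢y ∘ sym))))

  restrict-++ : ∀ u w → restrict x y (u ++ w) ≡ restrict x y u ++ restrict x y w
  restrict-++ = filter-++ (λ z → (z ≟ x) ⊎-dec (z ≟ y))

  restrict-OneOf : ∀ w → All OneOf (restrict x y w)
  restrict-OneOf = all-filter (λ z → (z ≟ x) ⊎-dec (z ≟ y))

  countXX-restrict : ∀ w →
    countXX x (restrict x y w) + countXX y (restrict x y w) ≡ repeats (restrict x y w)
  countXX-restrict w = countXX-repeats (restrict x y w) (restrict-OneOf w)

  xxyyCount : Word n → ℕ
  xxyyCount w = countXX x (restrict x y w) + countXX y (restrict x y w)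

  xxyyCount-cube⇔square : ∀ A X B → occ x X ≡ occ y X →
    (xxyyCount (A ++ X ++ X ++ X ++ B) ≤ 1) ⇔ (xxyyCount (A ++ X ++ X ++ B) ≤ 1)
  xxyyCount-cube⇔square A X B x≈y
    rewrite countXX-restrict (A ++ X ++ X ++ X ++ B) | countXX-restrict (A ++ X ++ X ++ B)
          | restrict-++ A (X ++ X ++ X ++ B) | restrict-++ A (X ++ X ++ B)
          | restrict-++ X (X ++ X ++ B) | restrict-++ X (X ++ B) | restrict-++ X B
    = repeats-cube⇔square (restrict x y A) (restrict x y X) (restrict x y B)
        (restrict-OneOf X)
        (occ x X , trans (length-restrict X)
                     (cong (occ x X +_) (trans (sym x≈y) (sym (+-identityʳ _)))))

Is1-11-Rep-dropCube : ∀ {n} (G : Graph n) (A X B : Word n) → Balanced X → X ≢ [] →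
  Is1-11-Rep G (A ++ X ++ X ++ X ++ B) → Is1-11-Rep G (A ++ X ++ X ++ B)
Is1-11-Rep-dropCube G A X B bal X≢[] (_ , rep) = nonempty , λ x y x≢y →
  let open TwoLetters x≢y
      cube⇔square = xxyyCount-cube⇔square A X B (bal x y)
      adjacent⇒ , ⇒adjacent = rep x y x≢y
  in Equivalence.to cube⇔square ∘ adjacent⇒ , ⇒adjacent ∘ Equivalence.from cube⇔square
  where
  nonempty : A ++ X ++ X ++ B ≢ []
  nonempty e = X≢[] (++-conicalˡ X _ (++-conicalʳ A _ e))

mainTheorem6 : ∀ {n : ℕ} (G : Graph n) (k : ℕ) → Rπ≡ G k →
    ∀ (w : Word n) → IsConcatOfPerms k w → Is1-11-Rep G w → CubeFree w
mainTheorem6 G _ (_ , minimal) _ (ps , refl , perms , refl) rep A X B X≢[] w≡ =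
  let balanced = cube-balanced A X B perms w≡
      j , j<k , fewer = halveSquare ps A perms balanced X≢[] w≡
  in minimal j j<k (A ++ X ++ X ++ B , fewer ,
       Is1-11-Rep-dropCube G A X B balanced X≢[] (subst (Is1-11-Rep G) w≡ rep))
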